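{- Let $s$ and $n\ge2$ be positive integers, $0\le k\le n$, let $t\ge2$ be a divisor of $s(n-1)+1$ and $\omega$ a primitive $t$-th root of unity. Then: (i) $\lim_{q\to\omega}{s(n-1)+k\brack k}_q{n-1\brack k}_q=\binom{\frac{s(n-1)+1+k}{t}-1}{\frac{k}{t}}\binom{\lfloor\frac{n-2}{t}\rfloor}{\frac{k}{t}}$ if $t|k$, and $0$ otherwise; (ii) $\lim_{q\to\omega}{s(n-1)+k\brack k}_q{n-2\brack k-1}_q=0$; (iii) $\lim_{q\to\omega}{s(n-1)+k\brack k}_q{n-2\brack k-2}_q=\binom{\frac{s(n-1)+1+k}{t}-1}{\frac{k}{t}}\binom{\frac{n}{t}-1}{\frac{k}{t}-1}$ if $t|k$ and $t|n$, and $0$ otherwise; (iv) $\lim_{q\to\omega}{s(n-1)+k-1\brack k}_q{n-2\brack k-2}_q=\binom{\frac{s(n-1)+1+k}{t}-1}{\frac{k}{t}}\binom{\frac{n}{t}-1}{\frac{k}{t}-1}$ if $t|k$ and $t|n$, and $0$ otherwise.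
   Context: ${m\brack i}_q=\frac{[m]!_q}{[i]!_q[m-i]!_q}$ (zero if $i<0$ or $i>m$), with $[m]_q=1+\cdots+q^{m-1}$ and $[m]!_q=[1]_q\cdots[m]_q$. -}

module Defs where

open import Level using (_⊔_)
open import Algebra.Bundles using (CommutativeRing; Semiring)
open import Data.Nat using (ℕ; zero; suc; _<_)
open import Data.Integer using (ℤ; +_; -[1+_])
open import Data.Nat.Combinatorics using (_C_)
open import Data.Sum using (_⊎_)
open import Data.Product using (_×_)
open import Relation.Nullary using (¬_)

chooseℤ : ℕ → ℤ → ℕ
chooseℤ m (+ i)    = m C i
chooseℤ m -[1+ _ ] = 0

module _ {c ℓ} (R : CommutativeRing c ℓ) where
  open CommutativeRing R
  open import Algebra.Definitions.RawSemiring (Semiring.rawSemiring semiring) using (_^_) renaming (_×_ to _·_)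

  -- The Gaussian binomial [m choose i]_q as a polynomial in q
  -- (defined by the q-Pascal rule), evaluated at q.
  -- It is 0 for i > m.
  qbin : Carrier → ℕ → ℕ → Carrier
  qbin q m       zero    = 1#
  qbin q zero    (suc i) = 0#
  qbin q (suc m) (suc i) = qbin q m i + (q ^ suc i) * qbin q m (suc i)

  qbinℤ : Carrier → ℕ → ℤ → Carrier
  qbinℤ q m (+ i)    = qbin q m i
  qbinℤ q m -[1+ _ ] = 0#

  fromℕ : ℕ → Carrier
  fromℕ n = n · 1#

  IsIntegralDomain : Set (c ⊔ ℓ)
  IsIntegralDomain =
    (¬ (1# ≈ 0#)) × (∀ x y → x * y ≈ 0# → (x ≈ 0#) ⊎ (y ≈ 0#))

  IsPrimitiveRoot : Carrier → ℕ → Set ℓ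
  IsPrimitiveRoot ω t = (ω ^ t ≈ 1#) × (∀ d → 0 < d → d < t → ¬ (ω ^ d ≈ 1#))

{-# OPTIONS --safe #-}

-- At a primitive t-th root of unity ω in an integral domain, [t, j]_ω = 0 for 0 < j < t
-- (ω^j fixes it and ω^j ≠ 1). Hence [m + t, i]_ω = [m, i]_ω + [m, i − t]_ω, and induction
-- gives the q-Lucas theorem [b + a t, d + c t]_ω = (a choose c) · [b, d]_ω for b, d < t.
-- As t ∣ s(n − 1) + 1, the upper index s(n − 1) + k is ≡ k − 1 (mod t); as t ∤ n − 1, the
-- residue of n − 2 is at most t − 2, and at most t − 3 unless t ∣ n. Comparing residues,
-- every factor is either an ordinary binomial coefficient or 0.
module Submission where

open import Algebra.Bundles using (CommutativeRing; Semiring)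
open import Data.Empty using (⊥-elim)
open import Data.Integer using (+_) renaming (_-_ to _-ℤ_)
import Data.Nat as ℕ
open ℕ using (ℕ; zero; suc; _≤_; _<_; NonZero; z≤n; s≤s)
open import Data.Nat.Combinatorics using (_C_; nCk+nC[k+1]≡[n+1]C[k+1])
open import Data.Nat.DivMod using (m≡m%n+[m/n]*n; m%n<n; m*n/n≡m)
open import Data.Nat.Divisibility using (_∣_; divides; _∣?_; ∣1⇒≡1; ∣m+n∣m⇒∣n; ∣-trans; n∣m*n)
import Data.Nat.Properties as ℕₚ
open import Data.Nat.Tactic.RingSolver using (solve-∀)
open import Data.Product using (_×_; _,_; ∃-syntax; proj₁; proj₂)
open import Data.Sum using (inj₁; inj₂)
open import Relation.Binary.PropositionalEquality as ≡ using (_≡_)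
open import Relation.Nullary using (¬_; yes; no)

open import Defs

b+[1+a]t≡b+at+t : ∀ a b t → b ℕ.+ suc a ℕ.* t ≡ b ℕ.+ a ℕ.* t ℕ.+ t
b+[1+a]t≡b+at+t = solve-∀

d+[1+c]t≡t+[d+ct] : ∀ c d t → d ℕ.+ suc c ℕ.* t ≡ t ℕ.+ (d ℕ.+ c ℕ.* t)
d+[1+c]t≡t+[d+ct] = solve-∀

b+ut+ct≡b+[u+c]t : ∀ b u c t → b ℕ.+ u ℕ.* t ℕ.+ c ℕ.* t ≡ b ℕ.+ (u ℕ.+ c) ℕ.* t
b+ut+ct≡b+[u+c]t = solve-∀

module QBinomial {r ℓ} (R : CommutativeRing r ℓ) where

  open CommutativeRing R hiding (zero)
  open import Algebra.Definitions.RawSemiring (Semiring.rawSemiring semiring) using (_^_)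
  open import Algebra.Properties.Semiring.Exp semiring using (^-homo-*; ^-congʳ)
  open import Algebra.Properties.Monoid.Mult +-monoid using (×-homo-1; ×-homo-+)
  open import Algebra.Properties.Semiring.Mult semiring using (×1-homo-*)
  open import Algebra.Properties.Ring ring using ([y-z]x≈yx-zx; x∙y⁻¹≈ε⇒x≈y; x≈y⇒x∙y⁻¹≈ε)
  open import Algebra.Solver.Ring.NaturalCoefficients.Default commutativeSemiring
  open import Relation.Binary.Reasoning.Setoid setoid

  x≈0⇒x*y≈0 : ∀ {x y} → x ≈ 0# → x * y ≈ 0#
  x≈0⇒x*y≈0 x≈0 = trans (*-congʳ x≈0) (zeroˡ _)

  y≈0⇒x*y≈0 : ∀ {x y} → y ≈ 0# → x * y ≈ 0#
  y≈0⇒x*y≈0 y≈0 = trans (*-congˡ y≈0) (zeroʳ _)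

  *-fromℕ : ∀ {x y} a b → x ≈ fromℕ R a → y ≈ fromℕ R b → x * y ≈ fromℕ R (a ℕ.* b)
  *-fromℕ a b x≈a y≈b = trans (*-cong x≈a y≈b) (sym (×1-homo-* a b))

  qbin-cong : ∀ q {m m′ i i′} → m ≡ m′ → i ≡ i′ → qbin R q m i ≈ qbin R q m′ i′
  qbin-cong q m≡m′ i≡i′ = reflexive (≡.cong₂ (qbin R q) m≡m′ i≡i′)

  qbin-congˡ : ∀ q {m m′} i → m ≡ m′ → qbin R q m i ≈ qbin R q m′ i
  qbin-congˡ q i m≡m′ = qbin-cong q m≡m′ (≡.refl {x = i})

  qbin-congʳ : ∀ q m {i i′} → i ≡ i′ → qbin R q m i ≈ qbin R q m i′
  qbin-congʳ q m i≡i′ = qbin-cong q (≡.refl {x = m}) i≡i′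

  qbin-vanishes : ∀ q {m i} → m < i → qbin R q m i ≈ 0#
  qbin-vanishes q {zero}  {suc i} _         = refl
  qbin-vanishes q {suc m} {suc i} (s≤s m<i) =
    trans (+-cong (qbin-vanishes q m<i) (y≈0⇒x*y≈0 (qbin-vanishes q (ℕₚ.m<n⇒m<1+n m<i)))) (+-identityʳ 0#)

  qbin-diagonal : ∀ q m → qbin R q m m ≈ 1#
  qbin-diagonal q zero    = refl
  qbin-diagonal q (suc m) =
    trans (+-cong (qbin-diagonal q m) (y≈0⇒x*y≈0 (qbin-vanishes q {m} ℕₚ.≤-refl))) (+-identityʳ 1#)

  qbin-pascal-mirror : ∀ q m i →
    qbin R q (suc m) (suc i) ≈ qbin R q m (suc i) + q ^ (m ℕ.∸ i) * qbin R q m i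
  qbin-pascal-mirror q zero zero =
    solve 1 (λ q → con 1 :+ (q :* con 1) :* con 0 := con 0 :+ con 1 :* con 1) refl q
  qbin-pascal-mirror q zero (suc i) =
    solve 1 (λ x → con 0 :+ x :* con 0 := con 0 :+ con 1 :* con 0) refl (q ^ suc (suc i))
  qbin-pascal-mirror q (suc m) zero = begin
    1# + (q * 1#) * qbin R q (suc m) 1
      ≈⟨ +-congˡ (*-congˡ (qbin-pascal-mirror q m zero)) ⟩
    1# + (q * 1#) * (qbin R q m 1 + q ^ m * 1#)
      ≈⟨ solve 3 (λ q a b → con 1 :+ (q :* con 1) :* (a :+ b :* con 1)
                         := (con 1 :+ (q :* con 1) :* a) :+ (q :* b) :* con 1) refl q (qbin R q m 1) (q ^ m) ⟩
    (1# + (q * 1#) * qbin R q m 1) + (q * q ^ m) * 1# ∎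
  qbin-pascal-mirror q (suc m) (suc j) = begin
    qbin R q (suc m) (suc j) + q ^ suc (suc j) * qbin R q (suc m) (suc (suc j))
      ≈⟨ +-cong (qbin-pascal-mirror q m j) (*-congˡ (qbin-pascal-mirror q m (suc j))) ⟩
    (a + q ^ (m ℕ.∸ j) * b) + q ^ suc (suc j) * (c + q ^ (m ℕ.∸ suc j) * a)
      ≈⟨ solve 6 (λ a b c E F Ga → (a :+ E :* b) :+ F :* (c :+ Ga) := (a :+ F :* c) :+ E :* b :+ F :* Ga)
                 refl a b c (q ^ (m ℕ.∸ j)) (q ^ suc (suc j)) (q ^ (m ℕ.∸ suc j) * a) ⟩
    (a + q ^ suc (suc j) * c) + q ^ (m ℕ.∸ j) * b + q ^ suc (suc j) * (q ^ (m ℕ.∸ suc j) * a)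
      ≈⟨ +-congˡ exponents-agree ⟩
    (a + q ^ suc (suc j) * c) + q ^ (m ℕ.∸ j) * b + q ^ (m ℕ.∸ j) * (q ^ suc j * a)
      ≈⟨ +-assoc _ _ _ ⟩
    (a + q ^ suc (suc j) * c) + (q ^ (m ℕ.∸ j) * b + q ^ (m ℕ.∸ j) * (q ^ suc j * a))
      ≈⟨ +-congˡ (distribˡ _ _ _) ⟨
    (a + q ^ suc (suc j) * c) + q ^ (m ℕ.∸ j) * (b + q ^ suc j * a) ∎
    where
    a b c : Carrier
    a = qbin R q m (suc j)
    b = qbin R q m j
    c = qbin R q m (suc (suc j))
    exponents-agree : q ^ suc (suc j) * (q ^ (m ℕ.∸ suc j) * a) ≈ q ^ (m ℕ.∸ j) * (q ^ suc j * a)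
    exponents-agree with j ℕ.<? m
    ... | yes j<m rewrite ℕₚ.+-∸-assoc 1 j<m =
      solve 4 (λ q h g a → (q :* h) :* (g :* a) := (q :* g) :* (h :* a)) refl q (q ^ suc j) (q ^ (m ℕ.∸ suc j)) a
    ... | no j≮m = trans (y≈0⇒x*y≈0 (y≈0⇒x*y≈0 a≈0)) (sym (y≈0⇒x*y≈0 (y≈0⇒x*y≈0 a≈0)))
      where
      a≈0 : a ≈ 0#
      a≈0 = qbin-vanishes q (s≤s (ℕₚ.≮⇒≥ j≮m))

  fixed-point-vanishes : IsIntegralDomain R → ∀ {a x} → ¬ (a ≈ 1#) → a * x ≈ x → x ≈ 0#
  fixed-point-vanishes (_ , no-zero-divisors) {a} {x} a≉1 ax≈x with no-zero-divisors (a - 1#) x [a-1]x≈0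
    where
    [a-1]x≈0 : (a - 1#) * x ≈ 0#
    [a-1]x≈0 = trans ([y-z]x≈yx-zx x a 1#) (x≈y⇒x∙y⁻¹≈ε (trans ax≈x (sym (*-identityˡ x))))
  ... | inj₁ a-1≈0 = ⊥-elim (a≉1 (x∙y⁻¹≈ε⇒x≈y a 1# a-1≈0))
  ... | inj₂ x≈0   = x≈0

  module AtPrimitiveRoot (domain : IsIntegralDomain R) (ω : Carrier) (t′ : ℕ)
                         (ω-root : IsPrimitiveRoot R ω (suc t′)) where

    private
      t : ℕ
      t = suc t′

      ω^t≈1 : ω ^ t ≈ 1#
      ω^t≈1 = proj₁ ω-root

      ω-primitive : ∀ d → 0 < d → d < t → ¬ (ω ^ d ≈ 1#)
      ω-primitive = proj₂ ω-root

    -- The two q-Pascal rules and ω^t = 1 give ω^(j+1) · [t, j+1] = [t, j+1].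
    qbin-root-vanishes : ∀ {j} → j < t′ → qbin R ω t (suc j) ≈ 0#
    qbin-root-vanishes {j} j<t′ =
      fixed-point-vanishes domain (ω-primitive (suc j) (s≤s z≤n) (s≤s j<t′)) (begin
        ω ^ suc j * qbin R ω t (suc j)
          ≈⟨ *-congˡ (qbin-pascal-mirror ω t′ j) ⟩
        ω ^ suc j * (qbin R ω t′ (suc j) + ω ^ (t′ ℕ.∸ j) * qbin R ω t′ j)
          ≈⟨ solve 4 (λ a b e c → a :* (b :+ e :* c) := c :* (a :* e) :+ a :* b)
                     refl (ω ^ suc j) (qbin R ω t′ (suc j)) (ω ^ (t′ ℕ.∸ j)) (qbin R ω t′ j) ⟩
        qbin R ω t′ j * (ω ^ suc j * ω ^ (t′ ℕ.∸ j)) + ω ^ suc j * qbin R ω t′ (suc j)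
          ≈⟨ +-congʳ (*-congˡ ω^[j+1+[t′-j]]≈1) ⟩
        qbin R ω t′ j * 1# + ω ^ suc j * qbin R ω t′ (suc j)
          ≈⟨ +-congʳ (*-identityʳ _) ⟩
        qbin R ω t (suc j) ∎)
      where
      ω^[j+1+[t′-j]]≈1 : ω ^ suc j * ω ^ (t′ ℕ.∸ j) ≈ 1#
      ω^[j+1+[t′-j]]≈1 = begin
        ω ^ suc j * ω ^ (t′ ℕ.∸ j) ≈⟨ ^-homo-* ω (suc j) (t′ ℕ.∸ j) ⟨
        ω ^ suc (j ℕ.+ (t′ ℕ.∸ j)) ≈⟨ ^-congʳ ω (≡.cong suc (ℕₚ.m+[n∸m]≡n (ℕₚ.<⇒≤ j<t′))) ⟩
        ω ^ t                      ≈⟨ ω^t≈1 ⟩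
        1# ∎

    qbin-shift-small : ∀ m {i} → i < t → qbin R ω (m ℕ.+ t) i ≈ qbin R ω m i
    qbin-shift-small zero    {zero}  _         = refl
    qbin-shift-small zero    {suc j} (s≤s j<t′) = qbin-root-vanishes j<t′
    qbin-shift-small (suc m) {zero}  _         = refl
    qbin-shift-small (suc m) {suc j} (s≤s j<t′) =
      +-cong (qbin-shift-small m (ℕₚ.m<n⇒m<1+n j<t′)) (*-congˡ (qbin-shift-small m (s≤s j<t′)))

    qbin-shift-large : ∀ m j → qbin R ω (m ℕ.+ t) (t ℕ.+ j) ≈ qbin R ω m (t ℕ.+ j) + qbin R ω m j
    qbin-shift-large zero zero = begin
      qbin R ω t (t ℕ.+ 0) ≈⟨ qbin-congʳ ω t (ℕₚ.+-identityʳ t) ⟩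
      qbin R ω t t         ≈⟨ qbin-diagonal ω t ⟩
      1#                   ≈⟨ +-identityˡ 1# ⟨
      0# + 1# ∎
    qbin-shift-large zero (suc j) = begin
      qbin R ω t (t ℕ.+ suc j) ≈⟨ qbin-vanishes ω (ℕₚ.m<m+n t (s≤s z≤n)) ⟩
      0#                       ≈⟨ +-identityˡ 0# ⟨
      0# + 0# ∎
    qbin-shift-large (suc m) zero = begin
      qbin R ω (m ℕ.+ t) (t′ ℕ.+ 0) + ω ^ (t ℕ.+ 0) * qbin R ω (m ℕ.+ t) (t ℕ.+ 0)
        ≈⟨ +-cong (qbin-shift-small m (≡.subst (ℕ._< t) (≡.sym (ℕₚ.+-identityʳ t′)) (ℕₚ.n<1+n t′)))
                  (*-cong ω^[t+0]≈1 (qbin-shift-large m zero)) ⟩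
      qbin R ω m (t′ ℕ.+ 0) + 1# * (qbin R ω m (t ℕ.+ 0) + 1#)
        ≈⟨ solve 2 (λ a b → a :+ con 1 :* (b :+ con 1) := (a :+ con 1 :* b) :+ con 1) refl _ _ ⟩
      (qbin R ω m (t′ ℕ.+ 0) + 1# * qbin R ω m (t ℕ.+ 0)) + 1#
        ≈⟨ +-congʳ (+-congˡ (*-congʳ ω^[t+0]≈1)) ⟨
      (qbin R ω m (t′ ℕ.+ 0) + ω ^ (t ℕ.+ 0) * qbin R ω m (t ℕ.+ 0)) + 1# ∎
      where
      ω^[t+0]≈1 : ω ^ (t ℕ.+ 0) ≈ 1#
      ω^[t+0]≈1 = trans (^-congʳ ω (ℕₚ.+-identityʳ t)) ω^t≈1
    qbin-shift-large (suc m) (suc j) = begin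
      qbin R ω (m ℕ.+ t) (t′ ℕ.+ suc j) + ω ^ (t ℕ.+ suc j) * qbin R ω (m ℕ.+ t) (t ℕ.+ suc j)
        ≈⟨ +-cong (trans (qbin-congʳ ω (m ℕ.+ t) (ℕₚ.+-suc t′ j)) (qbin-shift-large m j))
                  (*-cong ω^[t+j+1]≈ω^[j+1] (qbin-shift-large m (suc j))) ⟩
      (Q (t ℕ.+ j) + Q j) + ω ^ suc j * (Q (t ℕ.+ suc j) + Q (suc j))
        ≈⟨ solve 5 (λ a b w c d → (a :+ b) :+ w :* (c :+ d) := (a :+ w :* c) :+ (b :+ w :* d))
                   refl (Q (t ℕ.+ j)) (Q j) (ω ^ suc j) (Q (t ℕ.+ suc j)) (Q (suc j)) ⟩
      (Q (t ℕ.+ j) + ω ^ suc j * Q (t ℕ.+ suc j)) + (Q j + ω ^ suc j * Q (suc j))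
        ≈⟨ +-congʳ (+-cong (qbin-congʳ ω m (ℕₚ.+-suc t′ j)) (*-congʳ ω^[t+j+1]≈ω^[j+1])) ⟨
      (Q (t′ ℕ.+ suc j) + ω ^ (t ℕ.+ suc j) * Q (t ℕ.+ suc j)) + (Q j + ω ^ suc j * Q (suc j)) ∎
      where
      Q : ℕ → Carrier
      Q = qbin R ω m
      ω^[t+j+1]≈ω^[j+1] : ω ^ (t ℕ.+ suc j) ≈ ω ^ suc j
      ω^[t+j+1]≈ω^[j+1] = begin
        ω ^ (t ℕ.+ suc j)    ≈⟨ ^-homo-* ω t (suc j) ⟩
        ω ^ t * ω ^ suc j    ≈⟨ *-congʳ ω^t≈1 ⟩
        1# * ω ^ suc j       ≈⟨ *-identityˡ _ ⟩
        ω ^ suc j ∎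

    qbin-lucas : ∀ a c {b d} → b < t → d < t →
                 qbin R ω (b ℕ.+ a ℕ.* t) (d ℕ.+ c ℕ.* t) ≈ fromℕ R (a C c) * qbin R ω b d
    qbin-lucas zero zero {b} {d} _ _ = begin
      qbin R ω (b ℕ.+ 0) (d ℕ.+ 0) ≈⟨ qbin-cong ω (ℕₚ.+-identityʳ b) (ℕₚ.+-identityʳ d) ⟩
      qbin R ω b d                 ≈⟨ *-identityˡ _ ⟨
      1# * qbin R ω b d            ≈⟨ *-congʳ (×-homo-1 1#) ⟨
      fromℕ R 1 * qbin R ω b d ∎
    qbin-lucas zero (suc c) {b} {d} b<t _ = trans (qbin-vanishes ω b+0<d+[1+c]t) (sym (zeroˡ _))
      where
      b+0<d+[1+c]t : b ℕ.+ 0 ℕ.< d ℕ.+ suc c ℕ.* t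
      b+0<d+[1+c]t = ℕₚ.<-≤-trans (≡.subst (ℕ._< t) (≡.sym (ℕₚ.+-identityʳ b)) b<t)
                                  (ℕₚ.≤-trans (ℕₚ.m≤m+n t (c ℕ.* t)) (ℕₚ.m≤n+m _ d))
    qbin-lucas (suc a) zero {b} {d} b<t d<t = begin
      qbin R ω (b ℕ.+ suc a ℕ.* t) (d ℕ.+ 0) ≈⟨ qbin-congˡ ω (d ℕ.+ 0) (b+[1+a]t≡b+at+t a b t) ⟩
      qbin R ω (b ℕ.+ a ℕ.* t ℕ.+ t) (d ℕ.+ 0) ≈⟨ qbin-shift-small _ (≡.subst (ℕ._< t) (≡.sym (ℕₚ.+-identityʳ d)) d<t) ⟩
      qbin R ω (b ℕ.+ a ℕ.* t) (d ℕ.+ 0) ≈⟨ qbin-lucas a zero b<t d<t ⟩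
      fromℕ R 1 * qbin R ω b d ∎
    qbin-lucas (suc a) (suc c) {b} {d} b<t d<t = begin
      qbin R ω (b ℕ.+ suc a ℕ.* t) (d ℕ.+ suc c ℕ.* t)
        ≈⟨ qbin-cong ω (b+[1+a]t≡b+at+t a b t) (d+[1+c]t≡t+[d+ct] c d t) ⟩
      qbin R ω (b ℕ.+ a ℕ.* t ℕ.+ t) (t ℕ.+ (d ℕ.+ c ℕ.* t))
        ≈⟨ qbin-shift-large (b ℕ.+ a ℕ.* t) (d ℕ.+ c ℕ.* t) ⟩
      Q (t ℕ.+ (d ℕ.+ c ℕ.* t)) + Q (d ℕ.+ c ℕ.* t)
        ≈⟨ +-congʳ (qbin-congʳ ω (b ℕ.+ a ℕ.* t) (≡.sym (d+[1+c]t≡t+[d+ct] c d t))) ⟩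
      Q (d ℕ.+ suc c ℕ.* t) + Q (d ℕ.+ c ℕ.* t)
        ≈⟨ +-cong (qbin-lucas a (suc c) b<t d<t) (qbin-lucas a c b<t d<t) ⟩
      fromℕ R (a C suc c) * Y + fromℕ R (a C c) * Y
        ≈⟨ +-comm _ _ ⟩
      fromℕ R (a C c) * Y + fromℕ R (a C suc c) * Y
        ≈⟨ distribʳ Y _ _ ⟨
      (fromℕ R (a C c) + fromℕ R (a C suc c)) * Y
        ≈⟨ *-congʳ (×-homo-+ 1# (a C c) (a C suc c)) ⟨
      fromℕ R (a C c ℕ.+ a C suc c) * Y
        ≡⟨ ≡.cong (λ x → fromℕ R x * Y) (nCk+nC[k+1]≡[n+1]C[k+1] a c) ⟩
      fromℕ R (suc a C suc c) * Y ∎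
      where
      Q : ℕ → Carrier
      Q = qbin R ω (b ℕ.+ a ℕ.* t)
      Y : Carrier
      Y = qbin R ω b d

    qbin-lucas-vanishes : ∀ a c {b d} → b < d → d < t → qbin R ω (b ℕ.+ a ℕ.* t) (d ℕ.+ c ℕ.* t) ≈ 0#
    qbin-lucas-vanishes a c b<d d<t =
      trans (qbin-lucas a c (ℕₚ.<-trans b<d d<t) d<t) (y≈0⇒x*y≈0 (qbin-vanishes ω b<d))

    qbin-lucas-multiple : ∀ a c {b} → b < t → qbin R ω (b ℕ.+ a ℕ.* t) (c ℕ.* t) ≈ fromℕ R (a C c)
    qbin-lucas-multiple a c b<t = trans (qbin-lucas a c b<t (s≤s z≤n)) (*-identityʳ _)

    qbin-lucas-diagonal : ∀ a c {b} → b < t → qbin R ω (b ℕ.+ a ℕ.* t) (b ℕ.+ c ℕ.* t) ≈ fromℕ R (a C c)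
    qbin-lucas-diagonal a c {b} b<t =
      trans (qbin-lucas a c b<t b<t) (trans (*-congˡ (qbin-diagonal ω b)) (*-identityʳ _))

open import Data.Nat using (_+_; _*_; _∸_; _/_; _%_; _≥_)

data Division (t : ℕ) : ℕ → Set where
  division : ∀ r q → r < t → Division t (r + q * t)

divide : ∀ m t .{{_ : NonZero t}} → Division t m
divide m t = ≡.subst (Division t) (≡.sym (m≡m%n+[m/n]*n m t)) (division (m % t) (m / t) (m%n<n m t))

e+[n%t]≡t⇒t∣e+n : ∀ e n t .{{_ : NonZero t}} → e + n % t ≡ t → t ∣ e + n
e+[n%t]≡t⇒t∣e+n e n t e+r≡t = divides (suc (n / t)) (begin
  e + n                    ≡⟨ ≡.cong (λ x → e + x) (m≡m%n+[m/n]*n n t) ⟩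
  e + (n % t + n / t * t)  ≡⟨ ℕₚ.+-assoc e (n % t) (n / t * t) ⟨
  e + n % t + n / t * t    ≡⟨ ≡.cong (_+ n / t * t) e+r≡t ⟩
  suc (n / t) * t          ∎)
  where open ≡.≡-Reasoning

e+[n%t]<t : ∀ e n t .{{_ : NonZero t}} → e + n % t ≤ t → ¬ t ∣ e + n → e + n % t < t
e+[n%t]<t e n t e+r≤t t∤e+n = ℕₚ.≤∧≢⇒< e+r≤t (λ e+r≡t → t∤e+n (e+[n%t]≡t⇒t∣e+n e n t e+r≡t))

∣m+1⇒m≡t′+ut : ∀ {t′ m} → suc t′ ∣ m + 1 → ∃[ u ] m ≡ t′ + u * suc t′
∣m+1⇒m≡t′+ut {m = m} (divides zero    m+1≡0)        = ⊥-elim (ℕₚ.1+n≢0 (≡.trans (ℕₚ.+-comm 1 m) m+1≡0))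
∣m+1⇒m≡t′+ut {m = m} (divides (suc u) m+1≡[1+u]t) = u , ℕₚ.suc-injective (≡.trans (ℕₚ.+-comm 1 m) m+1≡[1+u]t)

∣m*n+1⇒∤n : ∀ {d} m {n} → 2 ≤ d → d ∣ m * n + 1 → ¬ d ∣ n
∣m*n+1⇒∤n {d} m 2≤d d∣mn+1 d∣n with ∣1⇒≡1 (∣m+n∣m⇒∣n d∣mn+1 (∣-trans d∣n (n∣m*n m)))
∣m*n+1⇒∤n {.1} m (s≤s ()) d∣mn+1 d∣n | ≡.refl

module Factors {r ℓ} (R : CommutativeRing r ℓ) (domain : IsIntegralDomain R)
               (ω : CommutativeRing.Carrier R) (t″ : ℕ) (ω-root : IsPrimitiveRoot R ω (suc (suc t″))) where

  open CommutativeRing R using (_≈_; 0#; refl; trans; reflexive; setoid)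
  open import Relation.Binary.Reasoning.Setoid setoid
  open QBinomial R using (qbin-congˡ; x≈0⇒x*y≈0; y≈0⇒x*y≈0; *-fromℕ)
  open QBinomial.AtPrimitiveRoot R domain ω (suc t″) ω-root

  t t′ : ℕ
  t  = suc (suc t″)
  t′ = suc t″

  -- The coefficient A of the statement, with N = X + 1.
  A : ℕ → ℕ → ℕ
  A X k = ((X + 1 + k) / t ∸ 1) C (k / t)

  A-at-multiple : ∀ u c → A (t′ + u * t) (c * t) ≡ (u + c) C c
  A-at-multiple u c =
    ≡.cong₂ _C_ (≡.trans (≡.cong (λ m → m / t ∸ 1) X+1+ct≡[1+u+c]t) (≡.cong (_∸ 1) (m*n/n≡m (suc u + c) t)))
                (m*n/n≡m c t)
    where
    X+1+ct≡[1+u+c]t : t′ + u * t + 1 + c * t ≡ (suc u + c) * t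
    X+1+ct≡[1+u+c]t = lemma t′ u c
      where
      lemma : ∀ t′ u c → t′ + u * suc t′ + 1 + c * suc t′ ≡ (suc u + c) * suc t′
      lemma = solve-∀

  qbin[X+ct,ct]≈A : ∀ {X} u → X ≡ t′ + u * t → ∀ c → qbin R ω (X + c * t) (c * t) ≈ fromℕ R (A X (c * t))
  qbin[X+ct,ct]≈A u ≡.refl c = begin
    qbin R ω (t′ + u * t + c * t) (c * t) ≈⟨ qbin-congˡ ω (c * t) (b+ut+ct≡b+[u+c]t t′ u c t) ⟩
    qbin R ω (t′ + (u + c) * t) (c * t)   ≈⟨ qbin-lucas-multiple (u + c) c ℕₚ.≤-refl ⟩
    fromℕ R ((u + c) C c)                 ≡⟨ ≡.cong (fromℕ R) (A-at-multiple u c) ⟨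
    fromℕ R (A (t′ + u * t) (c * t)) ∎

  qbin[X+ct-1,ct]≈A : ∀ {X} u → X ≡ t′ + u * t → ∀ c → qbin R ω (X + c * t ∸ 1) (c * t) ≈ fromℕ R (A X (c * t))
  qbin[X+ct-1,ct]≈A u ≡.refl c = begin
    qbin R ω (t″ + u * t + c * t) (c * t) ≈⟨ qbin-congˡ ω (c * t) (b+ut+ct≡b+[u+c]t t″ u c t) ⟩
    qbin R ω (t″ + (u + c) * t) (c * t)   ≈⟨ qbin-lucas-multiple (u + c) c (ℕₚ.m<n⇒m<1+n (ℕₚ.n<1+n t″)) ⟩
    fromℕ R ((u + c) C c)                 ≡⟨ ≡.cong (fromℕ R) (A-at-multiple u c) ⟨
    fromℕ R (A (t′ + u * t) (c * t)) ∎

  qbin[X+k,k]≈0 : ∀ {X k} u → X ≡ t′ + u * t → ¬ t ∣ k → qbin R ω (X + k) k ≈ 0#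
  qbin[X+k,k]≈0 {k = k} u ≡.refl t∤k with divide k t
  ... | division zero    c _     = ⊥-elim (t∤k (divides c ≡.refl))
  ... | division (suc d) c 1+d<t =
    trans (qbin-congˡ ω (suc d + c * t) (lemma t′ u c d)) (qbin-lucas-vanishes (suc u + c) c (ℕₚ.n<1+n d) 1+d<t)
    where
    lemma : ∀ t′ u c d → t′ + u * suc t′ + (suc d + c * suc t′) ≡ d + (suc u + c) * suc t′
    lemma = solve-∀

  qbin[X+k-1,k]≈0 : ∀ {X} u → X ≡ t′ + u * t → ∀ c d → 2 + d < t →
                    qbin R ω (X + (2 + d + c * t) ∸ 1) (2 + d + c * t) ≈ 0#
  qbin[X+k-1,k]≈0 u ≡.refl c d 2+d<t =
    trans (qbin-congˡ ω (2 + d + c * t) (lemma t″ u c d))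
          (qbin-lucas-vanishes (suc u + c) c (ℕₚ.m<n+m d (s≤s z≤n)) 2+d<t)
    where
    lemma : ∀ t″ u c d → t″ + u * suc (suc t″) + (2 + d + c * suc (suc t″)) ≡ d + (suc u + c) * suc (suc t″)
    lemma = solve-∀

  n%t<t′ : ∀ {n} → ¬ t ∣ suc n → n % t < t′
  n%t<t′ {n} t∤1+n = ℕ.s<s⁻¹ (e+[n%t]<t 1 n t (m%n<n n t) t∤1+n)

  qbin[1+n,ct]≈[n/t]Cc : ∀ {n} → ¬ t ∣ suc n → ∀ c → qbin R ω (suc n) (c * t) ≈ fromℕ R (n / t C c)
  qbin[1+n,ct]≈[n/t]Cc {n} t∤1+n c =
    trans (qbin-congˡ ω (c * t) (≡.cong suc (m≡m%n+[m/n]*n n t)))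
          (qbin-lucas-multiple (n / t) c (ℕ.s<s (n%t<t′ t∤1+n)))

  qbin[n,t′+ct]≈0 : ∀ {n} → ¬ t ∣ suc n → ∀ c → qbin R ω n (t′ + c * t) ≈ 0#
  qbin[n,t′+ct]≈0 {n} t∤1+n c =
    trans (qbin-congˡ ω (t′ + c * t) (m≡m%n+[m/n]*n n t)) (qbin-lucas-vanishes (n / t) c (n%t<t′ t∤1+n) ℕₚ.≤-refl)

  -- For k = (1 + c) t, the integer index k − 1 computes to t′ + c t and k − 2 to t″ + c t.
  qbinℤ[n,k-1]≈0 : ∀ {n k} → ¬ t ∣ suc n → t ∣ k → qbinℤ R ω n (+ k -ℤ + 1) ≈ 0#
  qbinℤ[n,k-1]≈0 t∤1+n (divides zero    ≡.refl) = refl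
  qbinℤ[n,k-1]≈0 t∤1+n (divides (suc c) ≡.refl) = qbin[n,t′+ct]≈0 t∤1+n c

  qbinℤ[n,1+ct-2]≈0 : ∀ {n} → ¬ t ∣ suc n → ∀ c → qbinℤ R ω n (+ (1 + c * t) -ℤ + 2) ≈ 0#
  qbinℤ[n,1+ct-2]≈0 t∤1+n zero    = refl
  qbinℤ[n,1+ct-2]≈0 t∤1+n (suc c) = qbin[n,t′+ct]≈0 t∤1+n c

  qbinℤ[n,k-2]≈0 : ∀ {n k} → ¬ t ∣ suc n → ¬ t ∣ suc (suc n) → t ∣ k → qbinℤ R ω n (+ k -ℤ + 2) ≈ 0#
  qbinℤ[n,k-2]≈0         t∤1+n t∤2+n (divides zero    ≡.refl) = refl
  qbinℤ[n,k-2]≈0 {n} t∤1+n t∤2+n (divides (suc c) ≡.refl) =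
    trans (qbin-congˡ ω (t″ + c * t) (m≡m%n+[m/n]*n n t)) (qbin-lucas-vanishes (n / t) c n%t<t″ (ℕₚ.m<n⇒m<1+n (ℕₚ.n<1+n t″)))
    where
    n%t<t″ : n % t < t″
    n%t<t″ = ℕ.s<s⁻¹ (ℕ.s<s⁻¹ (e+[n%t]<t 2 n t (ℕ.s<s (n%t<t′ t∤1+n)) t∤2+n))

  qbinℤ[n,ct-2]≈C : ∀ {n} → t ∣ suc (suc n) → ∀ c →
    qbinℤ R ω n (+ (c * t) -ℤ + 2) ≈ fromℕ R (chooseℤ (suc (suc n) / t ∸ 1) (+ (c * t / t) -ℤ + 1))
  qbinℤ[n,ct-2]≈C (divides (suc w) ≡.refl) zero    = refl
  qbinℤ[n,ct-2]≈C (divides (suc w) ≡.refl) (suc c) =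
    trans (qbin-lucas-diagonal w c (ℕₚ.m<n⇒m<1+n (ℕₚ.n<1+n t″)))
          (reflexive (≡.sym (≡.cong₂ (λ a b → fromℕ R (chooseℤ (a ∸ 1) (+ b -ℤ + 1))) (m*n/n≡m (suc w) t) (m*n/n≡m (suc c) t))))

  module Products (X u : ℕ) (X≡ : X ≡ t′ + u * t) (n : ℕ) (t∤1+n : ¬ t ∣ suc n) where

    open CommutativeRing R using () renaming (_*_ to _⊛_)

    part-i-multiple : ∀ {k} → t ∣ k → qbin R ω (X + k) k ⊛ qbin R ω (suc n) k ≈ fromℕ R (A X k * (n / t C (k / t)))
    part-i-multiple (divides c ≡.refl) =
      *-fromℕ (A X (c * t)) (n / t C (c * t / t)) (qbin[X+ct,ct]≈A u X≡ c)
              (trans (qbin[1+n,ct]≈[n/t]Cc t∤1+n c) (reflexive (≡.cong (λ c → fromℕ R (n / t C c)) (≡.sym (m*n/n≡m c t)))))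

    part-i-nonmultiple : ∀ {k} → ¬ t ∣ k → qbin R ω (X + k) k ⊛ qbin R ω (suc n) k ≈ 0#
    part-i-nonmultiple t∤k = x≈0⇒x*y≈0 (qbin[X+k,k]≈0 u X≡ t∤k)

    part-ii : ∀ k → qbin R ω (X + k) k ⊛ qbinℤ R ω n (+ k -ℤ + 1) ≈ 0#
    part-ii k with t ∣? k
    ... | yes t∣k = y≈0⇒x*y≈0 (qbinℤ[n,k-1]≈0 t∤1+n t∣k)
    ... | no  t∤k = x≈0⇒x*y≈0 (qbin[X+k,k]≈0 u X≡ t∤k)

    part-iii-multiple : ∀ {k} → t ∣ k → t ∣ suc (suc n) →
      qbin R ω (X + k) k ⊛ qbinℤ R ω n (+ k -ℤ + 2) ≈ fromℕ R (A X k * chooseℤ (suc (suc n) / t ∸ 1) (+ (k / t) -ℤ + 1))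
    part-iii-multiple (divides c ≡.refl) t∣2+n = *-fromℕ (A X (c * t)) _ (qbin[X+ct,ct]≈A u X≡ c) (qbinℤ[n,ct-2]≈C t∣2+n c)

    part-iii-other : ∀ {k} → ¬ (t ∣ k × t ∣ suc (suc n)) → qbin R ω (X + k) k ⊛ qbinℤ R ω n (+ k -ℤ + 2) ≈ 0#
    part-iii-other {k} ¬both with t ∣? k
    ... | yes t∣k = y≈0⇒x*y≈0 (qbinℤ[n,k-2]≈0 t∤1+n (λ t∣2+n → ¬both (t∣k , t∣2+n)) t∣k)
    ... | no  t∤k = x≈0⇒x*y≈0 (qbin[X+k,k]≈0 u X≡ t∤k)

    part-iv-multiple : ∀ {k} → t ∣ k → t ∣ suc (suc n) →
      qbin R ω (X + k ∸ 1) k ⊛ qbinℤ R ω n (+ k -ℤ + 2) ≈ fromℕ R (A X k * chooseℤ (suc (suc n) / t ∸ 1) (+ (k / t) -ℤ + 1))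
    part-iv-multiple (divides c ≡.refl) t∣2+n = *-fromℕ (A X (c * t)) _ (qbin[X+ct-1,ct]≈A u X≡ c) (qbinℤ[n,ct-2]≈C t∣2+n c)

    part-iv-other : ∀ {k} → ¬ (t ∣ k × t ∣ suc (suc n)) → qbin R ω (X + k ∸ 1) k ⊛ qbinℤ R ω n (+ k -ℤ + 2) ≈ 0#
    part-iv-other {k} ¬both with t ∣? k
    ... | yes t∣k = y≈0⇒x*y≈0 (qbinℤ[n,k-2]≈0 t∤1+n (λ t∣2+n → ¬both (t∣k , t∣2+n)) t∣k)
    ... | no  t∤k with divide k t
    ...   | division zero                c _     = ⊥-elim (t∤k (divides c ≡.refl))
    ...   | division (suc zero)          c _     = y≈0⇒x*y≈0 (qbinℤ[n,1+ct-2]≈0 t∤1+n c)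
    ...   | division (suc (suc d))       c 2+d<t = x≈0⇒x*y≈0 (qbin[X+k-1,k]≈0 u X≡ c d 2+d<t)

lemma5p3 : ∀ {c ℓ} (R : CommutativeRing c ℓ) → IsIntegralDomain R →
  (s n k t : ℕ) → .{{_ : NonZero t}} → s ≥ 1 → n ≥ 2 → k ≤ n → t ≥ 2 →
  t ∣ s * (n ∸ 1) + 1 →
  (ω : CommutativeRing.Carrier R) → IsPrimitiveRoot R ω t →
  let open CommutativeRing R using (_≈_) renaming (_*_ to _⊛_)
      open CommutativeRing R using (0#)
      N = s * (n ∸ 1) + 1
      A = ((N + k) / t ∸ 1) C (k / t)
  in
  -- (i)
  ((t ∣ k → qbin R ω (s * (n ∸ 1) + k) k ⊛ qbin R ω (n ∸ 1) k
              ≈ fromℕ R (A * (((n ∸ 2) / t) C (k / t))))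
   × (¬ (t ∣ k) → qbin R ω (s * (n ∸ 1) + k) k ⊛ qbin R ω (n ∸ 1) k ≈ 0#))
  -- (ii)
  × (qbin R ω (s * (n ∸ 1) + k) k ⊛ qbinℤ R ω (n ∸ 2) (+ k -ℤ + 1) ≈ 0#)
  -- (iii)
  × ((t ∣ k → t ∣ n → qbin R ω (s * (n ∸ 1) + k) k ⊛ qbinℤ R ω (n ∸ 2) (+ k -ℤ + 2)
              ≈ fromℕ R (A * chooseℤ (n / t ∸ 1) (+ (k / t) -ℤ + 1)))
     × (¬ (t ∣ k × t ∣ n) → qbin R ω (s * (n ∸ 1) + k) k ⊛ qbinℤ R ω (n ∸ 2) (+ k -ℤ + 2) ≈ 0#))
  -- (iv)
  × ((t ∣ k → t ∣ n → qbin R ω (s * (n ∸ 1) + k ∸ 1) k ⊛ qbinℤ R ω (n ∸ 2) (+ k -ℤ + 2)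
              ≈ fromℕ R (A * chooseℤ (n / t ∸ 1) (+ (k / t) -ℤ + 1)))
     × (¬ (t ∣ k × t ∣ n) → qbin R ω (s * (n ∸ 1) + k ∸ 1) k ⊛ qbinℤ R ω (n ∸ 2) (+ k -ℤ + 2) ≈ 0#))
lemma5p3 R domain s (suc (suc n)) k (suc (suc t″)) _ (s≤s (s≤s z≤n)) _ (s≤s (s≤s z≤n)) t∣N ω ω-root with ∣m+1⇒m≡t′+ut t∣N
... | u , X≡ =
  (part-i-multiple , part-i-nonmultiple) , part-ii k , (part-iii-multiple , part-iii-other) , (part-iv-multiple , part-iv-other)
  where open Factors.Products R domain ω t″ ω-root (s * suc n) u X≡ n (∣m*n+1⇒∤n s (s≤s (s≤s z≤n)) t∣N)
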